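{- The pomax game on a chess-colored Young diagram poset is balanced.
   Context: A Young diagram is a finite collection of cells arranged in left-justified rows with weakly decreasing row lengths (English notation). It is regarded as a poset in which a cell covers the cell immediately to its left and the cell immediately above it (when these exist). A coloring of a poset by black and white is a chess coloring if no element covers an element of the same color. The pomax game on a colored finite poset: White and Black alternately remove a maximal element (of the remaining subposet) of their own color; a player who cannot move loses. A position (a remaining set of elements with induced order and coloring) is balanced if (i) every position reachable from it in one move (by either player) is balanced, and (ii) whenever all its removable (here: maximal) elements are of the same color, at least half of its elements have that color. A colored poset is balanced if its pomax game is balanced. -}

module Defs where

open import Data.Nat using (ℕ; zero; suc; _<_; _≤_; _*_)
open import Data.Nat.Properties using () renaming (_≟_ to _≟ℕ_)
open import Data.Bool using (Bool)
open import Data.Bool.Properties using () renaming (_≟_ to _≟B_)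
open import Data.Product using (_×_; _,_)
open import Data.Product.Properties using (≡-dec)
open import Data.List using (List; []; _∷_; map; _++_; upTo; length; filter)
open import Data.List.Membership.Propositional using (_∈_)
open import Relation.Binary.PropositionalEquality using (_≡_; _≢_)
open import Relation.Binary.Construct.Closure.Transitive using (TransClosure)
open import Relation.Nullary using (¬_)
open import Relation.Nullary.Decidable using (¬?)

-- A cell (i , j) : row i, column j (both 0-based), English notation.
Cell : Set
Cell = ℕ × ℕ

_≟C_ : (x y : Cell) → Relation.Nullary.Dec (x ≡ y)
_≟C_ = ≡-dec _≟ℕ_ _≟ℕ_

-- A shape is given by its list of row lengths; rowLen sh i = length of row i
-- (0 beyond the last listed row).
rowLen : List ℕ → ℕ → ℕ
rowLen []       _       = 0
rowLen (r ∷ rs) zero    = r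
rowLen (r ∷ rs) (suc i) = rowLen rs i

IsYoung : List ℕ → Set
IsYoung sh = ∀ i → rowLen sh (suc i) ≤ rowLen sh i

InD : List ℕ → Cell → Set
InD sh (i , j) = j < rowLen sh i

cellsFrom : ℕ → List ℕ → List Cell
cellsFrom i []       = []
cellsFrom i (r ∷ rs) = map (λ j → (i , j)) (upTo r) ++ cellsFrom (suc i) rs

cells : List ℕ → List Cell
cells sh = cellsFrom 0 sh

data Covers (sh : List ℕ) : Cell → Cell → Set where
  left : ∀ {i j} → InD sh (i , suc j) → InD sh (i , j) → Covers sh (i , suc j) (i , j)
  up   : ∀ {i j} → InD sh (suc i , j) → InD sh (i , j) → Covers sh (suc i , j) (i , j)

CoveredBy : List ℕ → Cell → Cell → Set
CoveredBy sh x y = Covers sh y x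

_<[_]_ : Cell → List ℕ → Cell → Set
x <[ sh ] y = TransClosure (CoveredBy sh) x y

IsChess : List ℕ → (Cell → Bool) → Set
IsChess sh col = ∀ x y → Covers sh x y → col x ≢ col y

module Game (sh : List ℕ) (col : Cell → Bool) where

  -- A position is the list of remaining elements (a sub-list of cells sh).
  Maximal : List Cell → Cell → Set
  Maximal S x = x ∈ S × (∀ y → y ∈ S → ¬ (x <[ sh ] y))

  Removable : List Cell → Bool → Cell → Set
  Removable S c x = Maximal S x × col x ≡ c

  remove : Cell → List Cell → List Cell
  remove x S = filter (λ y → ¬? (y ≟C x)) S

  count : Bool → List Cell → ℕ
  count c S = length (filter (λ y → col y ≟B c) S)

  HalfCond : List Cell → Set
  HalfCond S = ∀ c → (∀ x → Maximal S x → col x ≡ c) → length S ≤ 2 * count c S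

  data Balanced (S : List Cell) : Set where
    balanced : (∀ c x → Removable S c x → Balanced (remove x S))
             → HalfCond S
             → Balanced S

BalancedPoset : List ℕ → (Cell → Bool) → Set
BalancedPoset sh col = Game.Balanced sh col (cells sh)

-- Every position reachable from the full diagram is the cell list of a Young diagram ν inside sh,
-- and the maximal cells of ν are its corners, so a move removes one corner.  A chess colouring
-- alternates along rows and columns, so each row holds one more, equally many, or one fewer cells
-- of a colour c than of the other, the last only for odd rows beginning and ending with not c.
-- If all corners have colour c, the last cell of such a row is no corner, so the row below it is
-- equally long and begins with c; its surplus cancels the deficit.

module Submission where

open import Defs
open import Data.Bool using (Bool; true; false; not; if_then_else_)
open import Data.Bool.Properties using (not-involutive; ¬-not) renaming (_≟_ to _≟ᴮ_)
open import Data.List using (List; []; _∷_; [_]; _++_; map; upTo; applyUpTo; length; filter)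
open import Data.List.Properties using (++-assoc; map-upTo; map-++; upTo-∷ʳ; length-++; length-map; length-upTo; filter-++; filter-all; filter-reject)
open import Data.List.Membership.Propositional using (_∈_; _∉_)
open import Data.List.Membership.Propositional.Properties using (∈-map⁺; ∈-map⁻; ∈-upTo⁺; ∈-upTo⁻; ∈-++⁺ˡ; ∈-++⁺ʳ; ∈-++⁻)
open import Data.List.Relation.Unary.All using (tabulate)
open import Data.Nat using (ℕ; zero; suc; pred; _+_; _*_; _≤_; _<_; _≤′_; ≤′-refl; ≤′-step; z≤n; s≤s; z<s)
open import Data.Nat.ListAction using (sum)
open import Data.Nat.Induction using (<-wellFounded)
open import Data.Nat.Properties
open import Data.Product using (_×_; _,_; proj₁; proj₂; ∃-syntax)
open import Data.Sum using (inj₁; inj₂)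
open import Function using (_∘_)
open import Induction.WellFounded using (Acc; acc)
open import Relation.Binary.PropositionalEquality hiding ([_])
open import Relation.Binary.Construct.Closure.Transitive using (_∷_) renaming ([_] to [_]⁺)
open import Relation.Nullary using (¬_; does; yes; no)
open import Relation.Nullary.Decidable using (¬?)

alternate : Bool → ℕ → Bool
alternate b zero    = b
alternate b (suc n) = not (alternate b n)

alternate-not : ∀ b n → alternate (not b) n ≡ not (alternate b n)
alternate-not b zero    = refl
alternate-not b (suc n) = cong not (alternate-not b n)

δ : Bool → Bool → ℕ
δ b c = if does (b ≟ᴮ c) then 1 else 0

alternatingCount : Bool → Bool → ℕ → ℕ
alternatingCount c b zero    = 0
alternatingCount c b (suc r) = δ b c + alternatingCount c (not b) r

-- The excess of c over not c among the first r terms of the alternating sequence from b,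
-- when positive; surplus c (not b) r is the corresponding deficit.
surplus : Bool → Bool → ℕ → ℕ
surplus c b zero          = 0
surplus c b (suc zero)    = δ b c
surplus c b (suc (suc r)) = surplus c b r

alternatingCount-+2 : ∀ c b r → alternatingCount c b (2 + r) ≡ suc (alternatingCount c b r)
alternatingCount-+2 false false r = refl
alternatingCount-+2 false true  r = refl
alternatingCount-+2 true  false r = refl
alternatingCount-+2 true  true  r = refl

alternatingCount-balance : ∀ c b r → 2 * alternatingCount c b r + surplus c (not b) r ≡ r + surplus c b r
alternatingCount-balance c     b     zero          = refl
alternatingCount-balance false false (suc zero)    = refl
alternatingCount-balance false true  (suc zero)    = refl
alternatingCount-balance true  false (suc zero)    = refl
alternatingCount-balance true  true  (suc zero)    = refl
alternatingCount-balance c     b     (suc (suc r)) = begin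
  2 * alternatingCount c b (2 + r) + surplus c (not b) r  ≡⟨ cong (λ n → 2 * n + surplus c (not b) r) (alternatingCount-+2 c b r) ⟩
  2 * suc (alternatingCount c b r) + surplus c (not b) r  ≡⟨ cong (_+ surplus c (not b) r) (*-suc 2 (alternatingCount c b r)) ⟩
  2 + (2 * alternatingCount c b r + surplus c (not b) r)  ≡⟨ cong (2 +_) (alternatingCount-balance c b r) ⟩
  2 + r + surplus c b r                                   ∎
  where open ≡-Reasoning

last≡⇒surplus-not≡0 : ∀ c b r → alternate b (pred r) ≡ c → surplus c (not b) r ≡ 0
last≡⇒surplus-not≡0 c     b zero                e    = refl
last≡⇒surplus-not≡0 false b (suc zero)          refl = refl
last≡⇒surplus-not≡0 true  b (suc zero)          refl = refl
last≡⇒surplus-not≡0 c     b (suc (suc zero))    e    = refl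
last≡⇒surplus-not≡0 c     b (suc (suc (suc r))) e    =
  last≡⇒surplus-not≡0 c b (suc r) (trans (sym (not-involutive _)) e)

alternatingRowCounts : Bool → Bool → List ℕ → ℕ
alternatingRowCounts c b []       = 0
alternatingRowCounts c b (r ∷ rs) = alternatingCount c b r + alternatingRowCounts c (not b) rs

CornerRowsEndIn : Bool → Bool → List ℕ → Set
CornerRowsEndIn c b μ =
  ∀ i → rowLen μ (suc i) < rowLen μ i → alternate (alternate b i) (pred (rowLen μ i)) ≡ c

sum+surplus≤2*alternatingRowCounts : ∀ c b μ → IsYoung μ → CornerRowsEndIn c b μ →
  sum μ + surplus c b (rowLen μ 0) ≤ 2 * alternatingRowCounts c b μ
sum+surplus≤2*alternatingRowCounts c b []       young corners = z≤n
sum+surplus≤2*alternatingRowCounts c b (r ∷ rs) young corners =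
  combine r (sum rs) (surplus c b r) (surplus c (not b) r) (alternatingCount c b r)
    (alternatingRowCounts c (not b) rs) (alternatingCount-balance c b r) deficit-absorbed
  where
  combine : ∀ r s p m a A → 2 * a + m ≡ r + p → s + m ≤ 2 * A → r + s + p ≤ 2 * (a + A)
  combine r s p m a A row rest = begin
    r + s + p        ≡⟨ +-assoc r s p ⟩
    r + (s + p)      ≡⟨ cong (r +_) (+-comm s p) ⟩
    r + (p + s)      ≡⟨ sym (+-assoc r p s) ⟩
    r + p + s        ≡⟨ cong (_+ s) (sym row) ⟩
    2 * a + m + s    ≡⟨ +-assoc (2 * a) m s ⟩
    2 * a + (m + s)  ≡⟨ cong (2 * a +_) (+-comm m s) ⟩
    2 * a + (s + m)  ≤⟨ +-monoʳ-≤ (2 * a) rest ⟩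
    2 * a + 2 * A    ≡⟨ sym (*-distribˡ-+ 2 a A) ⟩
    2 * (a + A)      ∎
    where open ≤-Reasoning

  below : sum rs + surplus c (not b) (rowLen rs 0) ≤ 2 * alternatingRowCounts c (not b) rs
  below = sum+surplus≤2*alternatingRowCounts c (not b) rs (λ i → young (suc i))
    (λ i lt → subst (λ b′ → alternate b′ (pred (rowLen rs i)) ≡ c) (sym (alternate-not b i)) (corners (suc i) lt))

  deficit-absorbed : sum rs + surplus c (not b) r ≤ 2 * alternatingRowCounts c (not b) rs
  deficit-absorbed with m≤n⇒m<n∨m≡n (young 0)
  ... | inj₂ same = subst (λ n → sum rs + surplus c (not b) n ≤ _) same below
  ... | inj₁ shorter rewrite last≡⇒surplus-not≡0 c b r (corners 0 shorter) =
    ≤-trans (≤-reflexive (+-identityʳ _)) (≤-trans (m≤m+n _ _) below)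

rowLen-antitone : ∀ ν → IsYoung ν → ∀ {m n} → m ≤ n → rowLen ν n ≤ rowLen ν m
rowLen-antitone ν young m≤n = go (≤⇒≤′ m≤n)
  where
  go : ∀ {m n} → m ≤′ n → rowLen ν n ≤ rowLen ν m
  go ≤′-refl        = ≤-refl
  go (≤′-step m≤′n) = ≤-trans (young _) (go m≤′n)

_⊑_ : List ℕ → List ℕ → Set
ν ⊑ μ = ∀ i → rowLen ν i ≤ rowLen μ i

IsCorner : List ℕ → Cell → Set
IsCorner ν (i , j) = rowLen ν i ≡ suc j × rowLen ν (suc i) ≤ j

shrinkRow : ℕ → List ℕ → List ℕ
shrinkRow t       []       = []
shrinkRow zero    (r ∷ rs) = pred r ∷ rs
shrinkRow (suc t) (r ∷ rs) = r ∷ shrinkRow t rs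

shrinkRow-⊑ : ∀ t ν → shrinkRow t ν ⊑ ν
shrinkRow-⊑ t       []       i       = ≤-refl
shrinkRow-⊑ zero    (r ∷ rs) zero    = pred[n]≤n
shrinkRow-⊑ zero    (r ∷ rs) (suc i) = ≤-refl
shrinkRow-⊑ (suc t) (r ∷ rs) zero    = ≤-refl
shrinkRow-⊑ (suc t) (r ∷ rs) (suc i) = shrinkRow-⊑ t rs i

shrinkRow-isYoung : ∀ t ν {j} → IsYoung ν → IsCorner ν (t , j) → IsYoung (shrinkRow t ν)
shrinkRow-isYoung zero    (r ∷ rs) young (refl , below) zero    = below
shrinkRow-isYoung zero    (r ∷ rs) young (refl , below) (suc i) = young (suc i)
shrinkRow-isYoung (suc t) (r ∷ rs) young corner         zero    = ≤-trans (shrinkRow-⊑ t rs 0) (young 0)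
shrinkRow-isYoung (suc t) (r ∷ rs) young corner         (suc i) =
  shrinkRow-isYoung t rs (λ i → young (suc i)) corner i

sum-shrinkRow : ∀ t ν {j} → rowLen ν t ≡ suc j → suc (sum (shrinkRow t ν)) ≡ sum ν
sum-shrinkRow zero    (r ∷ rs) refl = refl
sum-shrinkRow (suc t) (r ∷ rs) e    = trans (sym (+-suc r _)) (cong (r +_) (sum-shrinkRow t rs e))

row : ℕ → ℕ → List Cell
row i r = map (i ,_) (upTo r)

row-suc : ∀ i r → row i (suc r) ≡ row i r ++ [ (i , r) ]
row-suc i r = trans (cong (map (i ,_)) (sym (upTo-∷ʳ r))) (map-++ (i ,_) (upTo r) [ r ])

∈-row⁻ : ∀ {i r a j} → (a , j) ∈ row i r → a ≡ i × j < r
∈-row⁻ {i} x∈ with ∈-map⁻ (i ,_) x∈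
... | k , k∈ , refl = refl , ∈-upTo⁻ k∈

∈-cellsFrom⁺ : ∀ i μ t {j} → j < rowLen μ t → (i + t , j) ∈ cellsFrom i μ
∈-cellsFrom⁺ i (r ∷ rs) zero    j<r rewrite +-identityʳ i = ∈-++⁺ˡ (∈-map⁺ (i ,_) (∈-upTo⁺ j<r))
∈-cellsFrom⁺ i (r ∷ rs) (suc t) j<r rewrite +-suc i t = ∈-++⁺ʳ (row i r) (∈-cellsFrom⁺ (suc i) rs t j<r)

∈-cellsFrom⁻ : ∀ i μ {a j} → (a , j) ∈ cellsFrom i μ → ∃[ t ] a ≡ i + t × j < rowLen μ t
∈-cellsFrom⁻ i (r ∷ rs) x∈ with ∈-++⁻ (row i r) x∈
... | inj₁ x∈row with ∈-row⁻ x∈row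
...   | refl , j<r = 0 , sym (+-identityʳ i) , j<r
∈-cellsFrom⁻ i (r ∷ rs) x∈ | inj₂ x∈rest with ∈-cellsFrom⁻ (suc i) rs x∈rest
...   | t , refl , j<r = suc t , sym (+-suc i t) , j<r

∈-cells⁺ : ∀ ν {a j} → j < rowLen ν a → (a , j) ∈ cells ν
∈-cells⁺ ν {a} = ∈-cellsFrom⁺ 0 ν a

∈-cells⁻ : ∀ ν {a j} → (a , j) ∈ cells ν → j < rowLen ν a
∈-cells⁻ ν x∈ with ∈-cellsFrom⁻ 0 ν x∈
... | t , refl , j<r = j<r

length-cellsFrom : ∀ i μ → length (cellsFrom i μ) ≡ sum μ
length-cellsFrom i []       = refl
length-cellsFrom i (r ∷ rs) = begin
  length (row i r ++ cellsFrom (suc i) rs)           ≡⟨ length-++ (row i r) ⟩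
  length (row i r) + length (cellsFrom (suc i) rs)   ≡⟨ cong₂ _+_ (trans (length-map _ (upTo r)) (length-upTo r))
                                                                   (length-cellsFrom (suc i) rs) ⟩
  r + sum rs                                         ∎
  where open ≡-Reasoning

_≤ᶜ_ : Cell → Cell → Set
(i , j) ≤ᶜ (i′ , j′) = i ≤ i′ × j ≤ j′

≤ᶜ-refl : ∀ {x} → x ≤ᶜ x
≤ᶜ-refl = ≤-refl , ≤-refl

≤ᶜ-trans : ∀ {x y z} → x ≤ᶜ y → y ≤ᶜ z → x ≤ᶜ z
≤ᶜ-trans (i≤ , j≤) (i≤′ , j≤′) = ≤-trans i≤ i≤′ , ≤-trans j≤ j≤′

covers⇒≥ᶜ : ∀ {sh x y} → Covers sh x y → y ≤ᶜ x
covers⇒≥ᶜ (left _ _) = ≤-refl , n≤1+n _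
covers⇒≥ᶜ (up _ _)   = n≤1+n _ , ≤-refl

<⇒≤ᶜ : ∀ {sh x y} → x <[ sh ] y → x ≤ᶜ y
<⇒≤ᶜ [ x⋖y ]⁺    = covers⇒≥ᶜ x⋖y
<⇒≤ᶜ (x⋖z ∷ z<y) = ≤ᶜ-trans (covers⇒≥ᶜ x⋖z) (<⇒≤ᶜ z<y)

<⇒cover-≤ᶜ : ∀ {sh x y} → x <[ sh ] y → ∃[ z ] Covers sh z x × z ≤ᶜ y
<⇒cover-≤ᶜ [ x⋖y ]⁺    = _ , x⋖y , ≤ᶜ-refl
<⇒cover-≤ᶜ (x⋖z ∷ z<y) = _ , x⋖z , <⇒≤ᶜ z<y

InD-downward : ∀ ν → IsYoung ν → ∀ {x y} → x ≤ᶜ y → InD ν y → InD ν x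
InD-downward ν young (i≤i′ , j≤j′) j′<r = ≤-<-trans j≤j′ (<-≤-trans j′<r (rowLen-antitone ν young i≤i′))

chess⇒alternate : ∀ {sh col} → IsYoung sh → IsChess sh col →
  ∀ i j → InD sh (i , j) → col (i , j) ≡ alternate (alternate (col (0 , 0)) i) j
chess⇒alternate         young chess zero    zero    _  = refl
chess⇒alternate {sh}    young chess (suc i) zero    x∈ = trans (¬-not (chess _ _ (up x∈ above)))
                                                         (cong not (chess⇒alternate young chess i zero above))
  where
  above : InD sh (i , zero)
  above = <-≤-trans x∈ (young i)
chess⇒alternate {sh}    young chess i       (suc j) x∈ = trans (¬-not (chess _ _ (left x∈ before)))
                                                         (cong not (chess⇒alternate young chess i j before))
  where
  before : InD sh (i , j)
  before = ≤-<-trans (n≤1+n j) x∈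

module _ (sh : List ℕ) (col : Cell → Bool) where
  open Game sh col

  remove-absent : ∀ {x xs} → x ∉ xs → remove x xs ≡ xs
  remove-absent {x} x∉ = filter-all (λ y → ¬? (y ≟C x)) (tabulate λ y∈ y≡x → x∉ (subst (_∈ _) y≡x y∈))

  remove-corner : ∀ i μ t {j} → rowLen μ t ≡ suc j → remove (i + t , j) (cellsFrom i μ) ≡ cellsFrom i (shrinkRow t μ)
  remove-corner i (.(suc j) ∷ rs) zero {j} refl rewrite +-identityʳ i = begin
    remove x (row i (suc j) ++ R)          ≡⟨ cong (λ cs → remove x (cs ++ R)) (row-suc i j) ⟩
    remove x ((row i j ++ [ x ]) ++ R)     ≡⟨ cong (remove x) (++-assoc (row i j) [ x ] R) ⟩
    remove x (row i j ++ x ∷ R)            ≡⟨ filter-++ (λ y → ¬? (y ≟C x)) (row i j) (x ∷ R) ⟩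
    remove x (row i j) ++ remove x (x ∷ R) ≡⟨ cong₂ _++_ (remove-absent x∉row)
                                                (trans (filter-reject (λ y → ¬? (y ≟C x)) (λ x≢x → x≢x refl))
                                                       (remove-absent x∉R)) ⟩
    row i j ++ R                           ∎
    where
    open ≡-Reasoning
    x : Cell
    x = (i , j)
    R : List Cell
    R = cellsFrom (suc i) rs
    x∉row : x ∉ row i j
    x∉row x∈ = n≮n j (proj₂ (∈-row⁻ x∈))
    x∉R : x ∉ R
    x∉R x∈ with ∈-cellsFrom⁻ (suc i) rs x∈
    ... | t , i≡ , _ = m≢1+m+n i i≡
  remove-corner i (r ∷ rs) (suc t) {j} e rewrite +-suc i t = begin
    remove x (row i r ++ cellsFrom (suc i) rs)           ≡⟨ filter-++ (λ y → ¬? (y ≟C x)) (row i r) _ ⟩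
    remove x (row i r) ++ remove x (cellsFrom (suc i) rs) ≡⟨ cong₂ _++_ (remove-absent x∉row) (remove-corner (suc i) rs t e) ⟩
    row i r ++ cellsFrom (suc i) (shrinkRow t rs)         ∎
    where
    open ≡-Reasoning
    x : Cell
    x = (suc (i + t) , j)
    x∉row : x ∉ row i r
    x∉row x∈ = m≢1+m+n i (sym (proj₁ (∈-row⁻ x∈)))

  corner⇒maximal : ∀ ν → IsYoung ν → ∀ x → IsCorner ν x → Maximal (cells ν) x
  corner⇒maximal ν young (i , j) (rowEnd , below) = ∈-cells⁺ ν (≤-reflexive (sym rowEnd)) , nothing-above
    where
    nothing-above : ∀ y → y ∈ cells ν → ¬ ((i , j) <[ sh ] y)
    nothing-above (a , k) y∈ x<y with <⇒cover-≤ᶜ x<y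
    ... | _ , left _ _ , z≤y = n≮n (suc j) (subst (suc j <_) rowEnd (InD-downward ν young z≤y (∈-cells⁻ ν y∈)))
    ... | _ , up _ _   , z≤y = n≮n j (<-≤-trans (InD-downward ν young z≤y (∈-cells⁻ ν y∈)) below)

  maximal⇒corner : ∀ ν → ν ⊑ sh → ∀ x → Maximal (cells ν) x → IsCorner ν x
  maximal⇒corner ν ν⊑sh (i , j) (x∈ , maximal) =
    ≤-antisym (≮⇒≥ λ lt → maximal _ (∈-cells⁺ ν lt) [ left (inSh lt) (inSh j<r) ]⁺) j<r ,
    ≮⇒≥ λ lt → maximal _ (∈-cells⁺ ν lt) [ up (inSh lt) (inSh j<r) ]⁺
    where
    j<r : j < rowLen ν i
    j<r = ∈-cells⁻ ν x∈
    inSh : ∀ {a k} → k < rowLen ν a → InD sh (a , k)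
    inSh {a} k<r = <-≤-trans k<r (ν⊑sh a)

  count-++ : ∀ c xs ys → count c (xs ++ ys) ≡ count c xs + count c ys
  count-++ c xs ys = trans (cong length (filter-++ (λ y → col y ≟ᴮ c) xs ys)) (length-++ (filter (λ y → col y ≟ᴮ c) xs))

  count-alternating : ∀ c b (f : ℕ → Cell) r → (∀ k → k < r → col (f k) ≡ alternate b k) →
    count c (applyUpTo f r) ≡ alternatingCount c b r
  count-alternating c b f zero    colours = refl
  count-alternating c b f (suc r) colours rewrite colours 0 z<s
    with b ≟ᴮ c | count-alternating c (not b) (f ∘ suc) r
                    (λ k k<r → trans (colours (suc k) (s≤s k<r)) (sym (alternate-not b k)))
  ... | yes _ | rest = cong suc rest
  ... | no  _ | rest = rest

  count-cellsFrom : ∀ c b i μ → (∀ t j → j < rowLen μ t → col (i + t , j) ≡ alternate (alternate b (i + t)) j) →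
    count c (cellsFrom i μ) ≡ alternatingRowCounts c (alternate b i) μ
  count-cellsFrom c b i []       colours = refl
  count-cellsFrom c b i (r ∷ rs) colours = begin
    count c (row i r ++ cellsFrom (suc i) rs)            ≡⟨ count-++ c (row i r) _ ⟩
    count c (row i r) + count c (cellsFrom (suc i) rs)   ≡⟨ cong₂ _+_ (trans (cong (count c) (map-upTo (i ,_) r))
                                                                         (count-alternating c _ (i ,_) r row-colours))
                                                                  (count-cellsFrom c b (suc i) rs rest-colours) ⟩
    alternatingCount c (alternate b i) r + alternatingRowCounts c (alternate b (suc i)) rs ∎
    where
    open ≡-Reasoning
    colouredBy : ℕ → ℕ → Set
    colouredBy j a = col (a , j) ≡ alternate (alternate b a) j
    row-colours : ∀ j → j < r → colouredBy j i
    row-colours j j<r = subst (colouredBy j) (+-identityʳ i) (colours 0 j j<r)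
    rest-colours : ∀ t j → j < rowLen rs t → colouredBy j (suc i + t)
    rest-colours t j j<r = subst (colouredBy j) (+-suc i t) (colours (suc t) j j<r)

  module _ (young : IsYoung sh) (chess : IsChess sh col) where

    colour-formula : ∀ ν → ν ⊑ sh → ∀ t j → j < rowLen ν t → col (t , j) ≡ alternate (alternate (col (0 , 0)) t) j
    colour-formula ν ν⊑sh t j j<r = chess⇒alternate young chess t j (<-≤-trans j<r (ν⊑sh t))

    halfCond-cells : ∀ ν → IsYoung ν → ν ⊑ sh → HalfCond (cells ν)
    halfCond-cells ν youngν ν⊑sh c maximals≡c = begin
      length (cells ν)                                       ≡⟨ length-cellsFrom 0 ν ⟩
      sum ν                                                  ≤⟨ m≤m+n _ _ ⟩
      sum ν + surplus c (col (0 , 0)) (rowLen ν 0)           ≤⟨ sum+surplus≤2*alternatingRowCounts c _ ν youngν corners ⟩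
      2 * alternatingRowCounts c (col (0 , 0)) ν             ≡⟨ cong (2 *_) (count-cellsFrom c (col (0 , 0)) 0 ν (colour-formula ν ν⊑sh)) ⟨
      2 * count c (cells ν)                                  ∎
      where
      open ≤-Reasoning
      corners : CornerRowsEndIn c (col (0 , 0)) ν
      corners i longer with rowLen ν i in rowEnd
      ... | suc j = trans (sym (colour-formula ν ν⊑sh i j (≤-reflexive (sym rowEnd))))
                          (maximals≡c (i , j) (corner⇒maximal ν youngν (i , j) (rowEnd , ≤-pred longer)))

    balanced-cells : ∀ ν → IsYoung ν → ν ⊑ sh → Balanced (cells ν)
    balanced-cells ν = go ν (<-wellFounded _)
      where
      go : ∀ ν → Acc _<_ (sum ν) → IsYoung ν → ν ⊑ sh → Balanced (cells ν)
      go ν (acc smaller) youngν ν⊑sh = balanced move (halfCond-cells ν youngν ν⊑sh)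
        where
        move : ∀ c x → Removable (cells ν) c x → Balanced (remove x (cells ν))
        move c (t , j) (maximal , _) with maximal⇒corner ν ν⊑sh (t , j) maximal
        ... | corner@(rowEnd , _) = subst Balanced (sym (remove-corner 0 ν t rowEnd))
          (go (shrinkRow t ν) (smaller (≤-reflexive (sum-shrinkRow t ν rowEnd)))
              (shrinkRow-isYoung t ν youngν corner) (λ i → ≤-trans (shrinkRow-⊑ t ν i) (ν⊑sh i)))

mainTheorem4 : (sh : List ℕ) → IsYoung sh → (col : Cell → Bool) → IsChess sh col → BalancedPoset sh col
mainTheorem4 sh young col chess = balanced-cells sh col young chess sh young (λ _ → ≤-refl)
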